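{- Let $G=(L\cup R,E)$ be a bipartite graph with $|L|=|R|=n$, non-negative integer edge costs $c$, and a perfect matching. Let $\hat{y}'$ be a feasible integer dual solution and $y^*$ an optimal dual solution. Let $E'=\{ij\in E:\hat{y}'_i+\hat{y}'_j=c_{ij}\}$ be the set of edges tight under $\hat{y}'$. Then a maximum cardinality matching in the graph $(L\cup R,E')$ contains at least $n-\|y^*-\hat{y}'\|_0$ edges.
   Context: For minimum-weight perfect matching, the LP dual has a variable $y_v$ per vertex; $y$ is feasible if $y_i+y_j\le c_{ij}$ for all edges $ij$ ($i\in L$, $j\in R$), and optimal if it maximizes $\sum_v y_v$ among feasible duals. $\|x\|_0$ is the number of nonzero coordinates of $x$.
   Formalization: The optimal dual solution $y^*$ takes rational values and is optimal among rational feasible duals. -}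

module Defs where

open import Data.Nat using (ℕ; zero; suc; _+_; _≤_)
open import Data.Fin using (Fin; zero; suc)
open import Data.Integer using (ℤ; +_)
import Data.Integer as ℤ
open import Data.Rational using (ℚ; _/_; 0ℚ)
import Data.Rational as ℚ
open import Data.Rational.Properties using (_≟_)
open import Data.List using (List; map; length)
open import Data.List.Membership.Propositional using (_∈_)
open import Data.List.Relation.Unary.All using (All)
open import Data.List.Relation.Unary.Unique.Propositional using (Unique)
open import Data.Product using (_×_; _,_; proj₁; proj₂)
open import Relation.Nullary using (yes; no)
open import Relation.Binary.PropositionalEquality using (_≡_)

-- Bipartite graph G = (L ∪ R, E) with L = R = Fin n (as disjoint copies):
-- an edge set is a relation between left vertices and right vertices.
EdgeSet : ℕ → Set₁
EdgeSet n = Fin n → Fin n → Set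

record IsMatching {n : ℕ} (F : EdgeSet n) (M : List (Fin n × Fin n)) : Set where
  field
    inEdges   : All (λ e → F (proj₁ e) (proj₂ e)) M
    uniqueL   : Unique (map proj₁ M)
    uniqueR   : Unique (map proj₂ M)

record IsMaxMatching {n : ℕ} (F : EdgeSet n) (M : List (Fin n × Fin n)) : Set₁ where
  field
    matching : IsMatching F M
    maximum  : ∀ (M' : List (Fin n × Fin n)) → IsMatching F M' → length M' ≤ length M

HasPerfectMatching : {n : ℕ} → EdgeSet n → Set
HasPerfectMatching {n} E =
  Data.Product.Σ (List (Fin n × Fin n)) (λ M → IsMatching E M × length M ≡ n)

Dual : ℕ → Set
Dual n = (Fin n → ℚ) × (Fin n → ℚ)

IntDual : ℕ → Set
IntDual n = (Fin n → ℤ) × (Fin n → ℤ)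

ℤ→ℚ : ℤ → ℚ
ℤ→ℚ z = z / 1

ℕ→ℚ : ℕ → ℚ
ℕ→ℚ k = + k / 1

toDual : {n : ℕ} → IntDual n → Dual n
toDual (yL , yR) = (λ i → ℤ→ℚ (yL i)) , (λ j → ℤ→ℚ (yR j))

Σℚ : (n : ℕ) → (Fin n → ℚ) → ℚ
Σℚ zero    f = 0ℚ
Σℚ (suc n) f = f zero ℚ.+ Σℚ n (λ i → f (suc i))

dualValue : {n : ℕ} → Dual n → ℚ
dualValue {n} (yL , yR) = Σℚ n yL ℚ.+ Σℚ n yR

Feasible : {n : ℕ} → EdgeSet n → (Fin n → Fin n → ℕ) → Dual n → Set
Feasible E c (yL , yR) = ∀ i j → E i j → (yL i ℚ.+ yR j) ℚ.≤ ℕ→ℚ (c i j)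

Optimal : {n : ℕ} → EdgeSet n → (Fin n → Fin n → ℕ) → Dual n → Set
Optimal E c y = Feasible E c y × (∀ z → Feasible E c z → dualValue z ℚ.≤ dualValue y)

TightEdges : {n : ℕ} → EdgeSet n → (Fin n → Fin n → ℕ) → IntDual n → EdgeSet n
TightEdges E c (yL , yR) i j = E i j × (yL i ℤ.+ yR j ≡ + (c i j))

nnz : (n : ℕ) → (Fin n → ℚ) → ℕ
nnz zero    f = zero
nnz (suc n) f with f zero ≟ 0ℚ
... | yes _ = nnz n (λ i → f (suc i))
... | no  _ = suc (nnz n (λ i → f (suc i)))

dist0 : {n : ℕ} → Dual n → Dual n → ℕ
dist0 {n} (yL , yR) (zL , zR) =
  nnz n (λ i → yL i ℚ.- zL i) + nnz n (λ j → yR j ℚ.- zR j)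

{-# OPTIONS --safe #-}
-- Let M be a maximum matching of the ŷ'-tight graph. Call a left vertex reachable if an
-- M-alternating path of ŷ'-tight edges leads to it from an unmatched left vertex; let S be the
-- reachable vertices on which y* agrees with ŷ', and N the right vertices joined to S by y*-tight
-- edges. Raising y* by a small ε on S and lowering it by ε on N keeps it feasible and changes its
-- value by ε (|S| - |N|), so optimality gives |S| ≤ |N|. On the other hand a vertex of N on which
-- y* agrees with ŷ' is joined to S by a ŷ'-tight edge, so by maximality of M it is matched to a
-- reachable vertex, while every unreachable left vertex is matched. Counting edges of M then gives
-- |N| + n ≤ |S| + ‖y* - ŷ'‖₀ + |M|, hence n ≤ ‖y* - ŷ'‖₀ + |M|.

module Submission where

open import Defs
open import Data.Nat using (ℕ; zero; suc; _+_; _∸_; _<_; _≤_; _≤?_; z≤n; s≤s)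
open import Data.Fin using (Fin; zero; suc; _≟_)
open import Data.List using (List; []; _∷_; length; map; filter)
open import Data.Product using (_×_; _,_; proj₁; proj₂; ∃-syntax)
open import Level using (0ℓ)
open import Function using (_∘_; id; case_of_)
open import Data.Empty using (⊥; ⊥-elim)
open import Data.Sum using (_⊎_; inj₁; inj₂)
import Data.Nat.Properties as ℕₚ
open import Data.Nat.Solver using (module +-*-Solver)
open import Data.Fin.Properties using (sequence; suc-injective)
open import Data.Integer using (ℤ; +_)
import Data.Integer as ℤ
import Data.Integer.Properties as ℤₚ
open import Data.Rational using (ℚ; 0ℚ; 1ℚ; fromℚᵘ)
import Data.Rational as ℚ
import Data.Rational.Properties as ℚₚ
open import Data.Rational.Unnormalised using (mkℚᵘ; *≡*)
import Data.Rational.Unnormalised as ℚᵘ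
import Data.Rational.Unnormalised.Properties as ℚᵘₚ
open import Data.Rational.Solver using () renaming (module +-*-Solver to ℚ-Solver)
import Data.List.Membership.DecPropositional as DecMembership
open import Data.List.Membership.Propositional using (_∈_; _∉_)
open import Data.List.Membership.Propositional.Properties using (∈-map⁺; ∈-map⁻; ∈-filter⁺)
open import Data.List.Properties using (map-∘; map-cong; length-map)
open import Data.List.Relation.Unary.Any using (here; there)
open import Data.List.Relation.Unary.All as All using ([]; _∷_)
import Data.List.Relation.Unary.All.Properties as Allₚ
open import Data.List.Relation.Unary.AllPairs using ([]; _∷_)
open import Data.List.Relation.Unary.Unique.Propositional using (Unique)
open import Algebra.Bundles using (CommutativeMonoid)
import Algebra.Properties.CommutativeSemigroup as CommutativeSemigroupₚ
open import Algebra.Properties.Group ℚₚ.+-0-group using (x∙y⁻¹≈ε⇒x≈y)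
open import Algebra.Definitions.RawMonoid ℚ.+-0-rawMonoid using () renaming (_×_ to _·_)
open import Effect.Monad using (RawMonad)
open import Relation.Nullary using (¬_; Dec; yes; no; ¬?; contradiction)
open import Relation.Nullary.Decidable using (¬¬-excluded-middle; decidable-stable)
open import Relation.Nullary.Negation using (¬¬-Monad)
open import Relation.Unary using (Pred; Decidable; _⊆_; _∪_; _∩_; ∁)
open import Relation.Unary.Properties using (∅?; ∁?; _∩?_)
open import Relation.Binary.PropositionalEquality
  using (_≡_; _≢_; refl; sym; trans; cong; cong₂; subst; subst₂; module ≡-Reasoning)

_∈?_ : ∀ {n} (x : Fin n) xs → Dec (x ∈ xs)
_∈?_ = DecMembership._∈?_ _≟_

-- Counting

indicator : ∀ {P : Set} → Dec P → ℕ
indicator (yes _) = 1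
indicator (no  _) = 0

indicator-≤-+ : ∀ {P Q R : Set} (P? : Dec P) (Q? : Dec Q) (R? : Dec R) →
                (P → Q ⊎ R) → indicator P? ≤ indicator Q? + indicator R?
indicator-≤-+ (no _)  _       _       _ = z≤n
indicator-≤-+ (yes _) (yes _) _       _ = s≤s z≤n
indicator-≤-+ (yes _) (no _)  (yes _) _ = s≤s z≤n
indicator-≤-+ (yes p) (no ¬q) (no ¬r) P⇒Q⊎R with P⇒Q⊎R p
... | inj₁ q = contradiction q ¬q
... | inj₂ r = contradiction r ¬r

count : ∀ {n} {P : Pred (Fin n) 0ℓ} → Decidable P → ℕ
count {zero}  P? = 0
count {suc n} P? = indicator (P? zero) + count (P? ∘ suc)

count-none : ∀ {n} {P : Pred (Fin n) 0ℓ} (P? : Decidable P) → (∀ i → ¬ P i) → count P? ≡ 0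
count-none {zero}  P? ¬P = refl
count-none {suc n} P? ¬P with P? zero
... | yes p = contradiction p (¬P zero)
... | no  _ = count-none (P? ∘ suc) (¬P ∘ suc)

count-≤-+ : ∀ {n} {P Q R : Pred (Fin n) 0ℓ} (P? : Decidable P) (Q? : Decidable Q) (R? : Decidable R) →
            P ⊆ Q ∪ R → count P? ≤ count Q? + count R?
count-≤-+ {zero}  P? Q? R? P⊆Q∪R = z≤n
count-≤-+ {suc n} P? Q? R? P⊆Q∪R = ℕₚ.≤-trans
  (ℕₚ.+-mono-≤ (indicator-≤-+ (P? zero) (Q? zero) (R? zero) P⊆Q∪R)
               (count-≤-+ (P? ∘ suc) (Q? ∘ suc) (R? ∘ suc) P⊆Q∪R))
  (ℕₚ.≤-reflexive (CommutativeSemigroupₚ.interchange ℕₚ.+-commutativeSemigroup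
    (indicator (Q? zero)) (indicator (R? zero)) (count (Q? ∘ suc)) (count (R? ∘ suc))))

count-mono : ∀ {n} {P Q : Pred (Fin n) 0ℓ} (P? : Decidable P) (Q? : Decidable Q) →
             P ⊆ Q → count P? ≤ count Q?
count-mono {n} P? Q? P⊆Q = begin
  count P?                ≤⟨ count-≤-+ P? Q? ∅? (inj₁ ∘ P⊆Q) ⟩
  count Q? + count {n} ∅? ≡⟨ cong (λ m → count Q? + m) (count-none {n} ∅? λ _ ()) ⟩
  count Q? + 0            ≡⟨ ℕₚ.+-identityʳ (count Q?) ⟩
  count Q?                ∎
  where open ℕₚ.≤-Reasoning

count-≟-≤1 : ∀ {n} (x : Fin n) → count (_≟ x) ≤ 1
count-≟-≤1 {suc n} zero    = ℕₚ.≤-reflexive (cong suc (count-none {n} (λ i → suc i ≟ zero) λ _ ()))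
count-≟-≤1 {suc n} (suc x) =
  ℕₚ.≤-trans (count-mono (λ i → suc i ≟ suc x) (_≟ x) suc-injective) (count-≟-≤1 x)

count-≤-length : ∀ {n} {P : Pred (Fin n) 0ℓ} (P? : Decidable P) (xs : List (Fin n)) →
                 P ⊆ (_∈ xs) → count P? ≤ length xs
count-≤-length P? []       P⊆[] = ℕₚ.≤-reflexive (count-none P? λ _ p → case P⊆[] p of λ ())
count-≤-length {P = P} P? (x ∷ xs) P⊆x∷xs = ℕₚ.≤-trans
  (count-≤-+ P? (_≟ x) (P? ∩? (_∈? xs)) split)
  (ℕₚ.+-mono-≤ (count-≟-≤1 x) (count-≤-length (P? ∩? (_∈? xs)) xs proj₂))
  where
  split : P ⊆ (_≡ x) ∪ (P ∩ (_∈ xs))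
  split p with P⊆x∷xs p
  ... | here  i≡x  = inj₁ i≡x
  ... | there i∈xs = inj₂ (p , i∈xs)

count-complement : ∀ {n} {P : Pred (Fin n) 0ℓ} (P? : Decidable P) → count P? + count (∁? P?) ≡ n
count-complement {zero}  P? = refl
count-complement {suc n} P? with P? zero
... | yes _ = cong suc (count-complement (P? ∘ suc))
... | no  _ = trans (ℕₚ.+-suc _ _) (cong suc (count-complement (P? ∘ suc)))

nnz≡count : ∀ n (f : Fin n → ℚ) → nnz n f ≡ count (λ i → ¬? (f i ℚₚ.≟ 0ℚ))
nnz≡count zero    f = refl
nnz≡count (suc n) f with f zero ℚₚ.≟ 0ℚ
... | yes _ = nnz≡count n (f ∘ suc)
... | no  _ = cong suc (nnz≡count n (f ∘ suc))

length-filter-∁ : ∀ {A : Set} {P : Pred A 0ℓ} (P? : Decidable P) xs →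
                  length (filter P? xs) + length (filter (∁? P?) xs) ≡ length xs
length-filter-∁ P? []       = refl
length-filter-∁ P? (x ∷ xs) with P? x
... | yes _ = cong suc (length-filter-∁ P? xs)
... | no  _ = trans (ℕₚ.+-suc _ _) (cong suc (length-filter-∁ P? xs))

Unique-map-injective : ∀ {A B : Set} (f : A → B) {xs : List A} {x y : A} →
                       Unique (map f xs) → x ∈ xs → y ∈ xs → f x ≡ f y → x ≡ y
Unique-map-injective f _         (here refl) (here refl) _     = refl
Unique-map-injective f (fx∉ ∷ _) (here refl) (there y∈) fx≡fy =
  contradiction fx≡fy (All.lookup fx∉ (∈-map⁺ f y∈))
Unique-map-injective f (fy∉ ∷ _) (there x∈) (here refl) fx≡fy =
  contradiction (sym fx≡fy) (All.lookup fy∉ (∈-map⁺ f x∈))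
Unique-map-injective f (_ ∷ u)   (there x∈) (there y∈) fx≡fy = Unique-map-injective f u x∈ y∈ fx≡fy

-- Alternating paths

lefts rights : ∀ {n} → List (Fin n × Fin n) → List (Fin n)
lefts  = map proj₁
rights = map proj₂

module Alternating {n : ℕ} (H : EdgeSet n) where

  data Reachable (M : List (Fin n × Fin n)) : ℕ → Fin n → Set where
    free : ∀ {k l} → l ∉ lefts M → Reachable M k l
    step : ∀ {k l′ r l} → Reachable M k l′ → H l′ r → (l , r) ∈ M → Reachable M (suc k) l

  reachable-suc : ∀ {M k l} → Reachable M k l → Reachable M (suc k) l
  reachable-suc (free l∉)        = free l∉
  reachable-suc (step reach h m) = step (reachable-suc reach) h m

  rematch : Fin n → Fin n → Fin n × Fin n → Fin n × Fin n
  rematch l r (x , y) with x ≟ l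
  ... | yes _ = x , r
  ... | no  _ = x , y

  proj₁-rematch : ∀ l r e → proj₁ (rematch l r e) ≡ proj₁ e
  proj₁-rematch l r (x , y) with x ≟ l
  ... | yes _ = refl
  ... | no  _ = refl

  rematch-≢ : ∀ {l r x y} → x ≢ l → rematch l r (x , y) ≡ (x , y)
  rematch-≢ {l} {x = x} x≢l with x ≟ l
  ... | yes x≡l = contradiction x≡l x≢l
  ... | no  _   = refl

  lefts-rematch : ∀ l r M → lefts (map (rematch l r) M) ≡ lefts M
  lefts-rematch l r M = trans (sym (map-∘ M)) (map-cong (proj₁-rematch l r) M)

  rights-rematch-unique : ∀ {l r} M → Unique (lefts M) → Unique (rights M) → r ∉ rights M →
                          Unique (rights (map (rematch l r) M))
  rights-rematch-unique []      _ _ _ = []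
  rights-rematch-unique {l} {r} ((x , y) ∷ M) (x∉ ∷ uˡ) (y∉ ∷ uʳ) r∉ =
    Allₚ.map⁺ (Allₚ.map⁺ (All.tabulate (λ {e} → distinct e)))
      ∷ rights-rematch-unique M uˡ uʳ (r∉ ∘ there)
    where
    distinct : ∀ e → e ∈ M → proj₂ (rematch l r (x , y)) ≢ proj₂ (rematch l r e)
    distinct (x′ , y′) e∈ with x ≟ l | x′ ≟ l
    ... | yes x≡l | yes x′≡l = λ _ → All.lookup x∉ (∈-map⁺ proj₁ e∈) (trans x≡l (sym x′≡l))
    ... | yes _   | no  _    = λ r≡y′ → r∉ (there (subst (_∈ rights M) (sym r≡y′) (∈-map⁺ proj₂ e∈)))
    ... | no  _   | yes _    = λ y≡r → r∉ (here (sym y≡r))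
    ... | no  _   | no  _    = All.lookup y∉ (∈-map⁺ proj₂ e∈)

  rematch-isMatching : ∀ {M l r} → IsMatching H M → H l r → r ∉ rights M →
                       IsMatching H (map (rematch l r) M)
  rematch-isMatching {M} {l} {r} matching Hlr r∉ = record
    { inEdges = Allₚ.map⁺ (All.map edge inEdges)
    ; uniqueL = subst Unique (sym (lefts-rematch l r M)) uniqueL
    ; uniqueR = rights-rematch-unique M uniqueL uniqueR r∉
    }
    where
    open IsMatching matching
    edge : ∀ {e} → H (proj₁ e) (proj₂ e) → H (proj₁ (rematch l r e)) (proj₂ (rematch l r e))
    edge {x , y} h with x ≟ l
    ... | yes refl = Hlr
    ... | no  _    = h

  rematch-isMaxMatching : ∀ {M l r} → IsMaxMatching H M → H l r → r ∉ rights M →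
                          IsMaxMatching H (map (rematch l r) M)
  rematch-isMaxMatching {M} {l} {r} max Hlr r∉ = record
    { matching = rematch-isMatching matching Hlr r∉
    ; maximum  = λ M′ m′ → subst (length M′ ≤_) (sym (length-map (rematch l r) M)) (maximum M′ m′)
    }
    where open IsMaxMatching max

  rematch-frees-mate : ∀ {M l r r′} → Unique (rights M) → (l , r′) ∈ M → r ∉ rights M →
                       r′ ∉ rights (map (rematch l r) M)
  rematch-frees-mate {M} {l} {r} {r′} uʳ lr′∈ r∉ r′∈ with ∈-map⁻ proj₂ r′∈
  ... | e′ , e′∈ , r′≡ with ∈-map⁻ (rematch l r) e′∈
  ... | (x , y) , xy∈ , refl = old-edge x y r′≡ xy∈
    where
    old-edge : ∀ x y → r′ ≡ proj₂ (rematch l r (x , y)) → (x , y) ∈ M → ⊥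
    old-edge x y r′≡ xy∈ with x ≟ l
    ... | yes _   = r∉ (subst (_∈ rights M) r′≡ (∈-map⁺ proj₂ lr′∈))
    ... | no  x≢l = x≢l (cong proj₁ (Unique-map-injective proj₂ uʳ xy∈ lr′∈ (sym r′≡)))

  reachable-rematch : ∀ {M k l r v} → ¬ Reachable M k l → Reachable M k v →
                      Reachable (map (rematch l r) M) k v
  reachable-rematch {M} {l = l} {r} _ (free v∉) = free (subst (_ ∉_) (sym (lefts-rematch l r M)) v∉)
  reachable-rematch {M} {l = l} {r} {v} unreachable (step reach h vr′∈) with v ≟ l
  ... | yes refl = contradiction (step reach h vr′∈) unreachable
  ... | no  v≢l  = step (reachable-rematch (unreachable ∘ reachable-suc) reach) h
                        (subst (_∈ map (rematch l r) M) (rematch-≢ v≢l) (∈-map⁺ (rematch l r) vr′∈))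

  -- If l is reachable in fewer steps we are done;
  -- otherwise matching l to r instead of to its mate r′ gives a maximum matching in which r′ is
  -- free and the path to l′ (which avoids l) survives, and l′ is adjacent to r′.
  no-augmenting-path : ∀ {M k l r} → IsMaxMatching H M → Reachable M k l → H l r → r ∉ rights M → ⊥
  no-augmenting-path {M} {l = l} {r} max (free l∉) Hlr r∉ =
    ℕₚ.<-irrefl refl (maximum ((l , r) ∷ M) augmented)
    where
    open IsMaxMatching max
    open IsMatching matching
    augmented : IsMatching H ((l , r) ∷ M)
    augmented = record
      { inEdges = Hlr ∷ inEdges
      ; uniqueL = Allₚ.¬Any⇒All¬ _ l∉ ∷ uniqueL
      ; uniqueR = Allₚ.¬Any⇒All¬ _ r∉ ∷ uniqueR
      }
  no-augmenting-path max (step reach Hl′r′ lr′∈) Hlr r∉ = ¬¬-excluded-middle λ where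
    (yes reach-l)  → no-augmenting-path max reach-l Hlr r∉
    (no unreach-l) → no-augmenting-path (rematch-isMaxMatching max Hlr r∉)
                       (reachable-rematch unreach-l reach) Hl′r′
                       (rematch-frees-mate (IsMatching.uniqueR (IsMaxMatching.matching max)) lr′∈ r∉)

  reachable-mate : ∀ {M k l r} → IsMaxMatching H M → Reachable M k l → H l r →
                   ∃[ l′ ] (l′ , r) ∈ M × Reachable M (suc k) l′
  reachable-mate {M} {r = r} max reach Hlr with r ∈? rights M
  ... | no  r∉ = ⊥-elim (no-augmenting-path max reach Hlr r∉)
  ... | yes r∈ with ∈-map⁻ proj₂ r∈
  ...   | (l′ , _) , l′r∈ , refl = l′ , l′r∈ , step reach Hlr l′r∈

-- Rational arithmetic

-- ℤ→ℚ a is definitionally fromℚᵘ (mkℚᵘ a 0).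
ℤ→ℚ-injective : ∀ {a b} → ℤ→ℚ a ≡ ℤ→ℚ b → a ≡ b
ℤ→ℚ-injective {a} {b} eq with ℚₚ.fromℚᵘ-injective {mkℚᵘ a 0} {mkℚᵘ b 0} eq
... | *≡* a*1≡b*1 = trans (sym (ℤₚ.*-identityʳ a)) (trans a*1≡b*1 (ℤₚ.*-identityʳ b))

fromℚᵘ-homo-+ : ∀ p q → fromℚᵘ (p ℚᵘ.+ q) ≡ fromℚᵘ p ℚ.+ fromℚᵘ q
fromℚᵘ-homo-+ p q = ℚₚ.toℚᵘ-injective (ℚᵘₚ.≃-trans
  (ℚₚ.toℚᵘ-fromℚᵘ (p ℚᵘ.+ q))
  (ℚᵘₚ.≃-sym (ℚᵘₚ.≃-trans (ℚₚ.toℚᵘ-homo-+ (fromℚᵘ p) (fromℚᵘ q))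
                          (ℚᵘₚ.+-cong (ℚₚ.toℚᵘ-fromℚᵘ p) (ℚₚ.toℚᵘ-fromℚᵘ q)))))

ℤ→ℚ-homo-+ : ∀ a b → ℤ→ℚ (a ℤ.+ b) ≡ ℤ→ℚ a ℚ.+ ℤ→ℚ b
ℤ→ℚ-homo-+ a b = trans
  (ℚₚ.fromℚᵘ-cong {mkℚᵘ (a ℤ.+ b) 0} {mkℚᵘ a 0 ℚᵘ.+ mkℚᵘ b 0} (*≡* (cong (ℤ._* + 1) a+b≡a*1+b*1)))
  (fromℚᵘ-homo-+ (mkℚᵘ a 0) (mkℚᵘ b 0))
  where
  a+b≡a*1+b*1 : a ℤ.+ b ≡ a ℤ.* + 1 ℤ.+ b ℤ.* + 1
  a+b≡a*1+b*1 = sym (cong₂ ℤ._+_ (ℤₚ.*-identityʳ a) (ℤₚ.*-identityʳ b))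

p-q≡0⇒p≡q : ∀ p q → p ℚ.- q ≡ 0ℚ → p ≡ q
p-q≡0⇒p≡q = x∙y⁻¹≈ε⇒x≈y

+-interchange : ∀ p q r s → (p ℚ.+ q) ℚ.+ (r ℚ.+ s) ≡ (p ℚ.+ r) ℚ.+ (q ℚ.+ s)
+-interchange = CommutativeSemigroupₚ.interchange (CommutativeMonoid.commutativeSemigroup ℚₚ.+-0-commutativeMonoid)

0<p+q : ∀ {p q} → 0ℚ ℚ.< p → 0ℚ ℚ.< q → 0ℚ ℚ.< p ℚ.+ q
0<p+q {p} {q} 0<p 0<q = subst (ℚ._< p ℚ.+ q) (ℚₚ.+-identityˡ 0ℚ) (ℚₚ.+-mono-< 0<p 0<q)

0<p⊓q : ∀ {p q} → 0ℚ ℚ.< p → 0ℚ ℚ.< q → 0ℚ ℚ.< p ℚ.⊓ q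
0<p⊓q {p} {q} 0<p 0<q with ℚₚ.⊓-sel p q
... | inj₁ p⊓q≡p = subst (0ℚ ℚ.<_) (sym p⊓q≡p) 0<p
... | inj₂ p⊓q≡q = subst (0ℚ ℚ.<_) (sym p⊓q≡q) 0<q

0<suc·p : ∀ {p} → 0ℚ ℚ.< p → ∀ k → 0ℚ ℚ.< suc k · p
0<suc·p 0<p zero    = subst (0ℚ ℚ.<_) (sym (ℚₚ.+-identityʳ _)) 0<p
0<suc·p 0<p (suc k) = 0<p+q 0<p (0<suc·p 0<p k)

0<m·p+n·-p : ∀ {p} → 0ℚ ℚ.< p → ∀ {m n} → n < m → 0ℚ ℚ.< m · p ℚ.+ n · (ℚ.- p)
0<m·p+n·-p 0<p {suc m} {zero}  _ = subst (0ℚ ℚ.<_) (sym (ℚₚ.+-identityʳ _)) (0<suc·p 0<p m)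
0<m·p+n·-p {p} 0<p {suc m} {suc n} (s≤s n<m) = subst (0ℚ ℚ.<_) (sym cancel) (0<m·p+n·-p 0<p n<m)
  where
  open ℚ-Solver
  cancel : (p ℚ.+ m · p) ℚ.+ (ℚ.- p ℚ.+ n · (ℚ.- p)) ≡ m · p ℚ.+ n · (ℚ.- p)
  cancel = solve 3 (λ p a b → (p :+ a) :+ (:- p :+ b) := a :+ b) refl p (m · p) (n · (ℚ.- p))

positive-lower-bound : ∀ {n} (f : Fin n → ℚ) → ∃[ ε ] 0ℚ ℚ.< ε × (∀ i → 0ℚ ℚ.< f i → ε ℚ.≤ f i)
positive-lower-bound {zero}  f = 1ℚ , ℚₚ.positive⁻¹ 1ℚ , λ ()
positive-lower-bound {suc n} f with positive-lower-bound (f ∘ suc) | 0ℚ ℚₚ.<? f zero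
... | ε , 0<ε , ε≤f | no 0≮f₀ = ε , 0<ε , λ where
  zero    0<f₀ → contradiction 0<f₀ 0≮f₀
  (suc i) 0<fᵢ → ε≤f i 0<fᵢ
... | ε , 0<ε , ε≤f | yes 0<f₀ = ε ℚ.⊓ f zero , 0<p⊓q 0<ε 0<f₀ , λ where
  zero    _    → ℚₚ.p⊓q≤q ε (f zero)
  (suc i) 0<fᵢ → ℚₚ.≤-trans (ℚₚ.p⊓q≤p ε (f zero)) (ε≤f i 0<fᵢ)

uniform-slack : ∀ {n} (x c : Fin n → Fin n → ℚ) →
                ∃[ ε ] 0ℚ ℚ.< ε × (∀ i j → x i j ℚ.< c i j → x i j ℚ.+ ε ℚ.≤ c i j)
uniform-slack {n} x c = ε , 0<ε , fits
  where
  slack : Fin n → Fin n → ℚ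
  slack i j = c i j ℚ.- x i j
  row : ∀ i → ∃[ ε ] 0ℚ ℚ.< ε × (∀ j → 0ℚ ℚ.< slack i j → ε ℚ.≤ slack i j)
  row i = positive-lower-bound (slack i)
  rows : ∃[ ε ] 0ℚ ℚ.< ε × (∀ i → 0ℚ ℚ.< proj₁ (row i) → ε ℚ.≤ proj₁ (row i))
  rows = positive-lower-bound (proj₁ ∘ row)
  ε : ℚ
  ε = proj₁ rows
  0<ε : 0ℚ ℚ.< ε
  0<ε = proj₁ (proj₂ rows)
  fits : ∀ i j → x i j ℚ.< c i j → x i j ℚ.+ ε ℚ.≤ c i j
  fits i j x<c = begin
    x i j ℚ.+ ε          ≤⟨ ℚₚ.+-monoʳ-≤ (x i j) (ℚₚ.≤-trans ε≤rowᵢ (proj₂ (proj₂ (row i)) j 0<slack)) ⟩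
    x i j ℚ.+ slack i j  ≡⟨ solve 2 (λ x c → x :+ (c :- x) := c) refl (x i j) (c i j) ⟩
    c i j                ∎
    where
    open ℚₚ.≤-Reasoning
    open ℚ-Solver
    ε≤rowᵢ : ε ℚ.≤ proj₁ (row i)
    ε≤rowᵢ = proj₂ (proj₂ rows) i (proj₁ (proj₂ (row i)))
    0<slack : 0ℚ ℚ.< slack i j
    0<slack = subst (ℚ._< slack i j) (ℚₚ.+-inverseʳ (x i j)) (ℚₚ.+-monoˡ-< (ℚ.- x i j) x<c)

-- Perturbing a dual solution

select : ∀ {P : Set} → Dec P → ℚ → ℚ
select (yes _) q = q
select (no  _) _ = 0ℚ

Σℚ-+ : ∀ n (f g : Fin n → ℚ) → Σℚ n (λ i → f i ℚ.+ g i) ≡ Σℚ n f ℚ.+ Σℚ n g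
Σℚ-+ zero    f g = sym (ℚₚ.+-identityˡ 0ℚ)
Σℚ-+ (suc n) f g = trans (cong (f zero ℚ.+ g zero ℚ.+_) (Σℚ-+ n (f ∘ suc) (g ∘ suc)))
                         (+-interchange (f zero) (g zero) (Σℚ n (f ∘ suc)) (Σℚ n (g ∘ suc)))

Σℚ-select : ∀ {n} {P : Pred (Fin n) 0ℓ} (P? : Decidable P) q → Σℚ n (λ i → select (P? i) q) ≡ count P? · q
Σℚ-select {zero}  P? q = refl
Σℚ-select {suc n} P? q with P? zero
... | yes _ = cong (q ℚ.+_) (Σℚ-select (P? ∘ suc) q)
... | no  _ = trans (ℚₚ.+-identityˡ _) (Σℚ-select (P? ∘ suc) q)

CoversTightNeighbours : ∀ {n} → EdgeSet n → (Fin n → Fin n → ℕ) → Dual n →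
                        Pred (Fin n) 0ℓ → Pred (Fin n) 0ℓ → Set
CoversTightNeighbours E c (yL , yR) S N = ∀ {i j} → S i → E i j → yL i ℚ.+ yR j ≡ ℕ→ℚ (c i j) → N j

module Shift {n} {S N : Pred (Fin n) 0ℓ} (S? : Decidable S) (N? : Decidable N) (ε : ℚ) where

  shift : Dual n → Dual n
  shift (yL , yR) = (λ i → yL i ℚ.+ select (S? i) ε) , (λ j → yR j ℚ.+ select (N? j) (ℚ.- ε))

  dualValue-shift : ∀ y → dualValue (shift y) ≡ dualValue y ℚ.+ (count S? · ε ℚ.+ count N? · (ℚ.- ε))
  dualValue-shift (yL , yR) = begin
    Σℚ n (λ i → yL i ℚ.+ select (S? i) ε) ℚ.+ Σℚ n (λ j → yR j ℚ.+ select (N? j) (ℚ.- ε))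
      ≡⟨ cong₂ ℚ._+_ (Σℚ-+ n yL _) (Σℚ-+ n yR _) ⟩
    (Σℚ n yL ℚ.+ Σℚ n (λ i → select (S? i) ε)) ℚ.+ (Σℚ n yR ℚ.+ Σℚ n (λ j → select (N? j) (ℚ.- ε)))
      ≡⟨ cong₂ (λ a b → (Σℚ n yL ℚ.+ a) ℚ.+ (Σℚ n yR ℚ.+ b)) (Σℚ-select S? ε) (Σℚ-select N? (ℚ.- ε)) ⟩
    (Σℚ n yL ℚ.+ count S? · ε) ℚ.+ (Σℚ n yR ℚ.+ count N? · (ℚ.- ε))
      ≡⟨ +-interchange (Σℚ n yL) _ (Σℚ n yR) _ ⟩
    dualValue (yL , yR) ℚ.+ (count S? · ε ℚ.+ count N? · (ℚ.- ε)) ∎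
    where open ≡-Reasoning

  feasible-shift : ∀ {E c} {y : Dual n} → Feasible E c y → 0ℚ ℚ.≤ ε →
                   (∀ i j → proj₁ y i ℚ.+ proj₂ y j ℚ.< ℕ→ℚ (c i j) →
                            proj₁ y i ℚ.+ proj₂ y j ℚ.+ ε ℚ.≤ ℕ→ℚ (c i j)) →
                   CoversTightNeighbours E c y S N → Feasible E c (shift y)
  feasible-shift {E} {c} {yL , yR} feasible 0≤ε slack covers i j eᵢⱼ =
    subst (ℚ._≤ ℕ→ℚ (c i j)) (sym (+-interchange (yL i) _ (yR j) _)) (bound (S? i) (N? j))
    where
    x : ℚ
    x = yL i ℚ.+ yR j
    x≤c : x ℚ.≤ ℕ→ℚ (c i j)
    x≤c = feasible i j eᵢⱼ
    x+0≤c : x ℚ.+ 0ℚ ℚ.≤ ℕ→ℚ (c i j)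
    x+0≤c = subst (ℚ._≤ ℕ→ℚ (c i j)) (sym (ℚₚ.+-identityʳ x)) x≤c
    0-ε≤0 : 0ℚ ℚ.- ε ℚ.≤ 0ℚ
    0-ε≤0 = subst (ℚ._≤ 0ℚ) (sym (ℚₚ.+-identityˡ (ℚ.- ε))) (ℚₚ.neg-antimono-≤ 0≤ε)
    bound : (sᵢ : Dec (S i)) (nⱼ : Dec (N j)) →
            x ℚ.+ (select sᵢ ε ℚ.+ select nⱼ (ℚ.- ε)) ℚ.≤ ℕ→ℚ (c i j)
    bound (yes _)  (yes _)  = subst (λ d → x ℚ.+ d ℚ.≤ ℕ→ℚ (c i j)) (sym (ℚₚ.+-inverseʳ ε)) x+0≤c
    bound (no _)   (no _)   = subst (λ d → x ℚ.+ d ℚ.≤ ℕ→ℚ (c i j)) (sym (ℚₚ.+-identityʳ 0ℚ)) x+0≤c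
    bound (no _)   (yes _)  = ℚₚ.≤-trans (ℚₚ.+-monoʳ-≤ x 0-ε≤0) x+0≤c
    bound (yes sᵢ) (no ¬nⱼ) =
      subst (λ d → x ℚ.+ d ℚ.≤ ℕ→ℚ (c i j)) (sym (ℚₚ.+-identityʳ ε)) (slack i j x<c)
      where
      x<c : x ℚ.< ℕ→ℚ (c i j)
      x<c with x ℚₚ.<? ℕ→ℚ (c i j)
      ... | yes x<c = x<c
      ... | no  x≮c = contradiction (covers sᵢ eᵢⱼ (ℚₚ.≤-antisym x≤c (ℚₚ.≮⇒≥ x≮c))) ¬nⱼ

optimal⇒tight-Hall : ∀ {n E c} {y : Dual n} → Optimal E c y →
                     ∀ {S N} (S? : Decidable S) (N? : Decidable N) →
                     CoversTightNeighbours E c y S N → count S? ≤ count N?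
optimal⇒tight-Hall {E = E} {c} {y@(yL , yR)} (feasible , optimal) S? N? covers = ℕₚ.≮⇒≥ λ N<S →
  ℚₚ.<-irrefl refl (ℚₚ.<-≤-trans (improved N<S) (optimal (shift y) feasible′))
  where
  slack-bound : ∃[ ε ] 0ℚ ℚ.< ε × (∀ i j → yL i ℚ.+ yR j ℚ.< ℕ→ℚ (c i j) →
                                           yL i ℚ.+ yR j ℚ.+ ε ℚ.≤ ℕ→ℚ (c i j))
  slack-bound = uniform-slack (λ i j → yL i ℚ.+ yR j) (λ i j → ℕ→ℚ (c i j))
  ε : ℚ
  ε = proj₁ slack-bound
  0<ε : 0ℚ ℚ.< ε
  0<ε = proj₁ (proj₂ slack-bound)
  open Shift S? N? ε
  feasible′ : Feasible E c (shift y)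
  feasible′ = feasible-shift {E} {c} {y} feasible (ℚₚ.<⇒≤ 0<ε) (proj₂ (proj₂ slack-bound)) covers
  improved : count N? < count S? → dualValue y ℚ.< dualValue (shift y)
  improved N<S = subst₂ ℚ._<_ (ℚₚ.+-identityʳ (dualValue y)) (sym (dualValue-shift y))
    (ℚₚ.+-monoʳ-< (dualValue y) (0<m·p+n·-p 0<ε N<S))

module Deficiency {n} (E : EdgeSet n) (c : Fin n → Fin n → ℕ) (aL aR : Fin n → ℤ) (yL yR : Fin n → ℚ)
                  (M : List (Fin n × Fin n)) (max : IsMaxMatching (TightEdges E c (aL , aR)) M) where

  open Alternating (TightEdges E c (aL , aR))

  Reach : Pred (Fin n) 0ℓ
  Reach l = ∃[ k ] Reachable M k l

  -- Phrased as in dist0, whose two summands dL and dR then count the complements.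
  AgreeL AgreeR : Pred (Fin n) 0ℓ
  AgreeL i = yL i ℚ.- ℤ→ℚ (aL i) ≡ 0ℚ
  AgreeR j = yR j ℚ.- ℤ→ℚ (aR j) ≡ 0ℚ

  AgreeL? : Decidable AgreeL
  AgreeL? i = yL i ℚ.- ℤ→ℚ (aL i) ℚₚ.≟ 0ℚ

  AgreeR? : Decidable AgreeR
  AgreeR? j = yR j ℚ.- ℤ→ℚ (aR j) ℚₚ.≟ 0ℚ

  dL dR : ℕ
  dL = nnz n (λ i → yL i ℚ.- ℤ→ℚ (aL i))
  dR = nnz n (λ j → yR j ℚ.- ℤ→ℚ (aR j))

  S N : Pred (Fin n) 0ℓ
  S = Reach ∩ AgreeL
  N j = ∃[ i ] S i × E i j × yL i ℚ.+ yR j ≡ ℕ→ℚ (c i j)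

  covers : CoversTightNeighbours E c (yL , yR) S N
  covers Sᵢ eᵢⱼ tight = _ , Sᵢ , eᵢⱼ , tight

  agreeing-edge-tight : ∀ {i j} → AgreeL i → AgreeR j →
                        yL i ℚ.+ yR j ≡ ℕ→ℚ (c i j) → aL i ℤ.+ aR j ≡ + c i j
  agreeing-edge-tight {i} {j} agreeᵢ agreeⱼ tight = ℤ→ℚ-injective (begin
    ℤ→ℚ (aL i ℤ.+ aR j)       ≡⟨ ℤ→ℚ-homo-+ (aL i) (aR j) ⟩
    ℤ→ℚ (aL i) ℚ.+ ℤ→ℚ (aR j) ≡⟨ cong₂ ℚ._+_ (p-q≡0⇒p≡q (yL i) _ agreeᵢ) (p-q≡0⇒p≡q (yR j) _ agreeⱼ) ⟨
    yL i ℚ.+ yR j             ≡⟨ tight ⟩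
    ℕ→ℚ (c i j)               ∎)
    where open ≡-Reasoning

  module _ (Reach? : Decidable Reach) where

    S? : Decidable S
    S? = Reach? ∩? AgreeL?

    reached unreached : List (Fin n × Fin n)
    reached   = filter (Reach? ∘ proj₁) M
    unreached = filter (∁? (Reach? ∘ proj₁)) M

    unreachable-matched : ∁ Reach ⊆ (_∈ lefts unreached)
    unreachable-matched {l} ¬reach with l ∈? lefts M
    ... | no  l∉ = contradiction (0 , free l∉) ¬reach
    ... | yes l∈ with ∈-map⁻ proj₁ l∈
    ...   | _ , e∈ , refl = ∈-map⁺ proj₁ (∈-filter⁺ (∁? (Reach? ∘ proj₁)) e∈ ¬reach)

    agreeing-neighbour-matched : ∀ {j} → N j → AgreeR j → j ∈ rights reached
    agreeing-neighbour-matched (i , ((k , reach) , agreeᵢ) , eᵢⱼ , tight) agreeⱼ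
      with reachable-mate max reach (eᵢⱼ , agreeing-edge-tight agreeᵢ agreeⱼ tight)
    ... | _ , mate∈ , reach-mate = ∈-map⁺ proj₂ (∈-filter⁺ (Reach? ∘ proj₁) mate∈ (suc k , reach-mate))

    neighbours-bound : (N? : Decidable N) → count N? ≤ dR + length reached
    neighbours-bound N? = begin
      count N?
        ≤⟨ count-≤-+ N? (∁? AgreeR?) (_∈? rights reached) split ⟩
      count (∁? AgreeR?) + count (_∈? rights reached)
        ≤⟨ ℕₚ.+-mono-≤ (ℕₚ.≤-reflexive (sym (nnz≡count n _)))
                       (count-≤-length (_∈? rights reached) (rights reached) id) ⟩
      dR + length (rights reached)
        ≡⟨ cong (λ m → dR + m) (length-map proj₂ reached) ⟩
      dR + length reached ∎
      where
      open ℕₚ.≤-Reasoning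
      split : N ⊆ ∁ AgreeR ∪ (_∈ rights reached)
      split {j} Nⱼ with AgreeR? j
      ... | yes agreeⱼ  = inj₂ (agreeing-neighbour-matched Nⱼ agreeⱼ)
      ... | no  ¬agreeⱼ = inj₁ ¬agreeⱼ

    reachable-bound : count Reach? ≤ count S? + dL
    reachable-bound = ℕₚ.≤-trans (count-≤-+ Reach? S? (∁? AgreeL?) split)
                                 (ℕₚ.+-monoʳ-≤ (count S?) (ℕₚ.≤-reflexive (sym (nnz≡count n _))))
      where
      split : Reach ⊆ S ∪ ∁ AgreeL
      split {i} reachᵢ with AgreeL? i
      ... | yes agreeᵢ  = inj₁ (reachᵢ , agreeᵢ)
      ... | no  ¬agreeᵢ = inj₂ ¬agreeᵢ

    unreachable-bound : count (∁? Reach?) ≤ length unreached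
    unreachable-bound = ℕₚ.≤-trans (count-≤-length (∁? Reach?) (lefts unreached) unreachable-matched)
                                   (ℕₚ.≤-reflexive (length-map proj₁ unreached))

    deficiency : (N? : Decidable N) → count N? + n ≤ count S? + ((dL + dR) + length M)
    deficiency N? = begin
      count N? + n
        ≡⟨ cong (λ m → count N? + m) (sym (count-complement Reach?)) ⟩
      count N? + (count Reach? + count (∁? Reach?))
        ≤⟨ ℕₚ.+-mono-≤ (neighbours-bound N?) (ℕₚ.+-mono-≤ reachable-bound unreachable-bound) ⟩
      (dR + length reached) + ((count S? + dL) + length unreached)
        ≡⟨ solve 5 (λ dL dR s r u → (dR :+ r) :+ ((s :+ dL) :+ u) := s :+ ((dL :+ dR) :+ (r :+ u))) refl
                   dL dR (count S?) (length reached) (length unreached) ⟩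
      count S? + ((dL + dR) + (length reached + length unreached))
        ≡⟨ cong (λ m → count S? + ((dL + dR) + m)) (length-filter-∁ (Reach? ∘ proj₁) M) ⟩
      count S? + ((dL + dR) + length M) ∎
      where
      open ℕₚ.≤-Reasoning
      open +-*-Solver

-- E is an arbitrary relation, so Reach and N need not be decidable; as the goal is decidable,
-- it suffices to argue under double negation.
¬¬-decidable : ∀ {n} (P : Pred (Fin n) 0ℓ) → ¬ ¬ Decidable P
¬¬-decidable P = sequence (RawMonad.rawApplicative ¬¬-Monad) (λ _ → ¬¬-excluded-middle)

lemmaB8 : (n : ℕ) (E : EdgeSet n) (c : Fin n → Fin n → ℕ)
    → HasPerfectMatching E
    → (ŷ' : IntDual n) → Feasible E c (toDual ŷ')
    → (y* : Dual n) → Optimal E c y*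
    → (M : List (Fin n × Fin n)) → IsMaxMatching (TightEdges E c ŷ') M
    → n ∸ dist0 y* (toDual ŷ') ≤ length M
lemmaB8 n E c _ (aL , aR) _ (yL , yR) optimal M max =
  decidable-stable (n ∸ (dL + dR) ≤? length M) λ ¬bound →
    ¬¬-decidable Reach λ Reach? → ¬¬-decidable N λ N? →
      ¬bound (ℕₚ.m≤n+o⇒m∸n≤o n (dL + dR) (ℕₚ.+-cancelˡ-≤ (count N?) n (dL + dR + length M) (begin
        count N? + n                              ≤⟨ deficiency Reach? N? ⟩
        count (S? Reach?) + (dL + dR + length M)  ≤⟨ ℕₚ.+-monoˡ-≤ (dL + dR + length M) (hall Reach? N?) ⟩
        count N? + (dL + dR + length M)           ∎)))
  where
  open Deficiency E c aL aR yL yR M max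
  open ℕₚ.≤-Reasoning
  hall : (Reach? : Decidable Reach) (N? : Decidable N) → count (S? Reach?) ≤ count N?
  hall Reach? N? = optimal⇒tight-Hall {E = E} {c} optimal (S? Reach?) N? covers
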